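{- Let $S$ be a sorting sequence of length $p$ with $r>1$ distinct values and multiplicities $p_1,\dots,p_r$, and let $F_{\min}$ be the minimum of $f$ over all general solutions for $S$. Then $F_{\min}=\sum_{i=1}^r (i-1)p_i=\sum_{i=2}^r\sum_{m=i}^r p_m$. If $k<r-1$ there are no general solutions satisfying the height bound for $k$; if $k\ge r-1$, the minimum number of fake coins over general solutions satisfying the height bound for $k$ is $F_{\min}$, and the maximum is $pk-F'_{\min}$, where $F'_{\min}$ is the corresponding minimum for the reverse sequence $S'$.
   Context: A sorting sequence of length $p$ is a non-decreasing sequence of $p$ non-negative integers beginning with $0$ in which each entry equals the previous one or exceeds it by $1$ (it records the outcome of sorting $p$ piles of $k$ coins by weight, fake coins being lighter than real ones). If its distinct entries are $0,\dots,r-1$, let $p_i\ge1$ be the number of entries equal to $i-1$, so $p_1+\dots+p_r=p$. A general solution with $f$ fake coins is an integer tuple $(f_1,\dots,f_r)$ with $0\le f_1<\dots<f_r$ and $\sum_i p_if_i=f$ ($f_i$ = number of fake coins in each pile marked $i-1$); it satisfies the height bound for $k$ if $f_r\le k$. The reverse sequence $S'$ is the sorting sequence of length $p$ with $r$ distinct values in which the number of entries equal to $i-1$ is $p_{r-i+1}$. -}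

module Defs where

open import Data.Nat using (ℕ; zero; suc; _+_; _*_; _∸_; _≤_; _<_; _⊔_; _<?_)
import Data.Fin
open import Relation.Nullary using (yes; no)
open import Data.Nat.Properties using (_≟_)
open import Data.Fin using (Fin; toℕ; fromℕ)
open import Data.List using (List; []; _∷_; length; filter; foldr)
open import Data.Product using (Σ; _×_)
open import Relation.Binary.PropositionalEquality using (_≡_)
open import Relation.Nullary using (¬_)

data Steps : ℕ → List ℕ → Set where
  done : ∀ {a} → Steps a []
  same : ∀ {a xs} → Steps a xs → Steps a (a ∷ xs)
  up   : ∀ {a xs} → Steps (suc a) xs → Steps a (suc a ∷ xs)

data IsSortingSeq : List ℕ → Set where
  sortingSeq : ∀ {xs} → Steps 0 xs → IsSortingSeq (0 ∷ xs)

-- number r of distinct values (= 1 + largest entry, for a sorting sequence)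
numValues : List ℕ → ℕ
numValues s = suc (foldr _⊔_ 0 s)

mult : List ℕ → ℕ → ℕ
mult s v = length (filter (λ x → x ≟ v) s)

-- 1-indexed multiplicity p_i, i = 1..r
pm : List ℕ → ℕ → ℕ
pm s i = mult s (i ∸ 1)

sumBelow : ℕ → (ℕ → ℕ) → ℕ
sumBelow zero    g = 0
sumBelow (suc n) g = sumBelow n g + g n

sumRange : ℕ → ℕ → (ℕ → ℕ) → ℕ
sumRange a b g = sumBelow (suc b ∸ a) (λ j → g (a + j))

-- a general solution (f_1,…,f_r) is indexed as fs : Fin r → ℕ, fs i = f_{i+1}
StrictlyIncreasing : ∀ {n} → (Fin n → ℕ) → Set
StrictlyIncreasing {n} fs = ∀ (i j : Fin n) → toℕ i < toℕ j → fs i < fs j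

totalFake : (s : List ℕ) → (Fin (numValues s) → ℕ) → ℕ
totalFake s fs = sumBelow (numValues s) g
  where
  g : ℕ → ℕ
  g j with j <? numValues s
  ... | yes j<r = mult s j * fs (Data.Fin.fromℕ< j<r)
  ... | no _ = 0

IsGeneralSolution : (s : List ℕ) → (Fin (numValues s) → ℕ) → ℕ → Set
IsGeneralSolution s fs f = StrictlyIncreasing fs × totalFake s fs ≡ f

HasGenSol : List ℕ → ℕ → Set
HasGenSol s f = Σ (Fin (numValues s) → ℕ) λ fs → IsGeneralSolution s fs f

HasHeightSol : List ℕ → ℕ → ℕ → Set
HasHeightSol s k f = Σ (Fin (numValues s) → ℕ) λ fs →
  IsGeneralSolution s fs f × fs (fromℕ (foldr _⊔_ 0 s)) ≤ k

IsMinimum : (ℕ → Set) → ℕ → Set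
IsMinimum P m = P m × (∀ n → P n → m ≤ n)

IsMaximum : (ℕ → Set) → ℕ → Set
IsMaximum P m = P m × (∀ n → P n → n ≤ m)

IsReverse : List ℕ → List ℕ → Set
IsReverse s s' = IsSortingSeq s' × length s' ≡ length s × numValues s' ≡ numValues s
  × (∀ i → 1 ≤ i → i ≤ numValues s → pm s' i ≡ pm s (numValues s ∸ i + 1))

-- A strictly increasing sequence of naturals satisfies f_i ≥ i - 1, and under the height bound
-- f_r ≤ k also f_i ≤ k - (r - i); both bounds are themselves solutions, so they give the minimum
-- and the maximum of Σ p_i f_i.  The maximum Σ p_i (k - (r - i)) is p k - Σ p_i (r - i), and the
-- subtracted sum is the minimum for the reverse sequence.  The tail form of F_min is an exchange
-- of summation.  Nothing uses that s is a sorting sequence or that r > 1.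
module Submission where

open import Defs
open import Data.Nat using (ℕ; zero; suc; _+_; _*_; _∸_; _⊔_; _≤_; _<_; z≤n; s≤s; _<?_)
open import Data.Nat.Properties
open import Algebra.Properties.CommutativeSemigroup +-commutativeSemigroup using (interchange)
open import Data.Fin as Fin using (Fin; toℕ; fromℕ; fromℕ<)
open import Data.Fin.Properties using (toℕ-fromℕ<; fromℕ<-toℕ; toℕ-fromℕ; toℕ-injective; toℕ<n)
open import Data.List using (List; []; _∷_; [_]; _++_; length; foldr; filter)
open import Data.List.Properties using (length-++; filter-++; filter-accept; filter-reject)
open import Data.Product using (_×_; ∃; _,_; proj₁; proj₂)
open import Data.Sum using (inj₁; inj₂)
open import Data.Empty using (⊥-elim)
open import Relation.Nullary using (¬_; yes; no)
open import Relation.Binary.PropositionalEquality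
  using (_≡_; _≢_; refl; sym; trans; cong; cong₂; subst; module ≡-Reasoning)

sumBelow-cong : ∀ n {g h : ℕ → ℕ} → (∀ j → j < n → g j ≡ h j) → sumBelow n g ≡ sumBelow n h
sumBelow-cong zero    eq = refl
sumBelow-cong (suc n) eq = cong₂ _+_ (sumBelow-cong n (λ j j<n → eq j (m<n⇒m<1+n j<n))) (eq n ≤-refl)

sumBelow-mono-≤ : ∀ n {g h : ℕ → ℕ} → (∀ j → j < n → g j ≤ h j) → sumBelow n g ≤ sumBelow n h
sumBelow-mono-≤ zero    le = z≤n
sumBelow-mono-≤ (suc n) le = +-mono-≤ (sumBelow-mono-≤ n (λ j j<n → le j (m<n⇒m<1+n j<n))) (le n ≤-refl)

sumBelow-zero : ∀ n → sumBelow n (λ _ → 0) ≡ 0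
sumBelow-zero zero    = refl
sumBelow-zero (suc n) = cong (_+ 0) (sumBelow-zero n)

sumBelow-distrib-+ : ∀ n (g h : ℕ → ℕ) →
                     sumBelow n (λ j → g j + h j) ≡ sumBelow n g + sumBelow n h
sumBelow-distrib-+ zero    g h = refl
sumBelow-distrib-+ (suc n) g h =
  trans (cong (_+ (g n + h n)) (sumBelow-distrib-+ n g h)) (interchange (sumBelow n g) (sumBelow n h) (g n) (h n))

sumBelow-*ʳ : ∀ n (g : ℕ → ℕ) c → sumBelow n (λ j → g j * c) ≡ sumBelow n g * c
sumBelow-*ʳ zero    g c = refl
sumBelow-*ʳ (suc n) g c =
  trans (cong (_+ g n * c) (sumBelow-*ʳ n g c)) (sym (*-distribʳ-+ c (sumBelow n g) (g n)))

sumBelow-suc : ∀ n (g : ℕ → ℕ) → sumBelow (suc n) g ≡ g 0 + sumBelow n (λ j → g (suc j))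
sumBelow-suc zero    g = +-comm 0 (g 0)
sumBelow-suc (suc n) g =
  trans (cong (_+ g (suc n)) (sumBelow-suc n g)) (+-assoc (g 0) _ (g (suc n)))

sumBelow-reverse : ∀ n (g : ℕ → ℕ) → sumBelow n g ≡ sumBelow n (λ j → g (n ∸ suc j))
sumBelow-reverse zero    g = refl
sumBelow-reverse (suc n) g = begin
  sumBelow n g + g n                          ≡⟨ cong (_+ g n) (sumBelow-reverse n g) ⟩
  sumBelow n (λ j → g (n ∸ suc j)) + g n      ≡⟨ +-comm _ (g n) ⟩
  g n + sumBelow n (λ j → g (n ∸ suc j))      ≡⟨ sym (sumBelow-suc n (λ j → g (n ∸ j))) ⟩
  sumBelow (suc n) (λ j → g (n ∸ j))          ∎
  where open ≡-Reasoning

-- Exchange of summation: the term q j is counted once in each tail starting at or below j.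
sumBelow-tails : ∀ n (q : ℕ → ℕ) →
                 sumBelow n (λ j → suc j * q j) ≡ sumBelow n (λ j → sumBelow (n ∸ j) (λ l → q (j + l)))
sumBelow-tails zero    q = refl
sumBelow-tails (suc n) q = begin
  sumBelow (suc n) (λ j → q j + j * q j)
    ≡⟨ sumBelow-distrib-+ (suc n) q (λ j → j * q j) ⟩
  sumBelow (suc n) q + sumBelow (suc n) (λ j → j * q j)
    ≡⟨ cong (sumBelow (suc n) q +_) (sumBelow-suc n (λ j → j * q j)) ⟩
  sumBelow (suc n) q + sumBelow n (λ j → suc j * q (suc j))
    ≡⟨ cong (sumBelow (suc n) q +_) (sumBelow-tails n (λ j → q (suc j))) ⟩
  sumBelow (suc n) q + sumBelow n (λ j → sumBelow (n ∸ j) (λ l → q (suc (j + l))))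
    ≡⟨ sym (sumBelow-suc n (λ j → sumBelow (suc n ∸ j) (λ l → q (j + l)))) ⟩
  sumBelow (suc n) (λ j → sumBelow (suc n ∸ j) (λ l → q (j + l)))
    ∎
  where open ≡-Reasoning

mult-++ : ∀ xs ys v → mult (xs ++ ys) v ≡ mult xs v + mult ys v
mult-++ xs ys v = trans (cong length (filter-++ (_≟ v) xs ys)) (length-++ (filter (_≟ v) xs))

mult-[x]-self : ∀ x → mult [ x ] x ≡ 1
mult-[x]-self x = cong length (filter-accept (_≟ x) refl)

mult-[x]-≢ : ∀ {x v} → x ≢ v → mult [ x ] v ≡ 0
mult-[x]-≢ {v = v} x≢v = cong length (filter-reject (_≟ v) x≢v)

sumBelow-mult-[x]≡0 : ∀ x n → n ≤ x → sumBelow n (mult [ x ]) ≡ 0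
sumBelow-mult-[x]≡0 x zero    _   = refl
sumBelow-mult-[x]≡0 x (suc n) n<x =
  cong₂ _+_ (sumBelow-mult-[x]≡0 x n (<⇒≤ n<x)) (mult-[x]-≢ (>⇒≢ n<x))

sumBelow-mult-[x]≡1 : ∀ x n → x < n → sumBelow n (mult [ x ]) ≡ 1
sumBelow-mult-[x]≡1 x (suc n) x<1+n with x ≟ n
... | yes refl = cong₂ _+_ (sumBelow-mult-[x]≡0 x x ≤-refl) (mult-[x]-self x)
... | no  x≢n  = cong₂ _+_ (sumBelow-mult-[x]≡1 x n (≤∧≢⇒< (m<1+n⇒m≤n x<1+n) x≢n)) (mult-[x]-≢ x≢n)

sumBelow-mult≡length : ∀ xs n → foldr _⊔_ 0 xs < n → sumBelow n (mult xs) ≡ length xs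
sumBelow-mult≡length []       n _  = sumBelow-zero n
sumBelow-mult≡length (x ∷ xs) n lt = begin
  sumBelow n (mult (x ∷ xs))                    ≡⟨ sumBelow-cong n (λ j _ → mult-++ [ x ] xs j) ⟩
  sumBelow n (λ j → mult [ x ] j + mult xs j)   ≡⟨ sumBelow-distrib-+ n (mult [ x ]) (mult xs) ⟩
  sumBelow n (mult [ x ]) + sumBelow n (mult xs)
    ≡⟨ cong₂ _+_ (sumBelow-mult-[x]≡1 x n (≤-<-trans (m≤m⊔n x _) lt))
                 (sumBelow-mult≡length xs n (≤-<-trans (m≤n⊔m x _) lt)) ⟩
  suc (length xs)                               ∎
  where open ≡-Reasoning

module _ {n} {fs : Fin n → ℕ} (fs↑ : StrictlyIncreasing fs) where

  strictlyIncreasing⇒monotone : ∀ i j → toℕ i ≤ toℕ j → fs i ≤ fs j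
  strictlyIncreasing⇒monotone i j i≤j with m≤n⇒m<n∨m≡n i≤j
  ... | inj₁ i<j = <⇒≤ (fs↑ i j i<j)
  ... | inj₂ i≡j = ≤-reflexive (cong fs (toℕ-injective i≡j))

  -- Each of the d positions between i and j raises the value by at least one.
  strictlyIncreasing-gap : ∀ d i j → toℕ i + d ≤ toℕ j → fs i + d ≤ fs j
  strictlyIncreasing-gap zero i j le =
    subst (_≤ fs j) (sym (+-identityʳ (fs i)))
      (strictlyIncreasing⇒monotone i j (subst (_≤ toℕ j) (+-identityʳ (toℕ i)) le))
  strictlyIncreasing-gap (suc d) i j le = begin
    fs i + suc d    ≡⟨ +-suc (fs i) d ⟩
    suc (fs i + d)  ≤⟨ s≤s (strictlyIncreasing-gap d i k (≤-reflexive (sym toℕk))) ⟩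
    suc (fs k)      ≤⟨ fs↑ k j (subst (_< toℕ j) (sym toℕk) i+d<j) ⟩
    fs j            ∎
    where
    open ≤-Reasoning
    i+d<j : toℕ i + d < toℕ j
    i+d<j = subst (_≤ toℕ j) (+-suc (toℕ i) d) le
    k : Fin n
    k = fromℕ< (<-≤-trans i+d<j (<⇒≤ (toℕ<n j)))
    toℕk : toℕ k ≡ toℕ i + d
    toℕk = toℕ-fromℕ< _

strictlyIncreasing⇒toℕ≤ : ∀ {m} {fs : Fin (suc m) → ℕ} → StrictlyIncreasing fs →
                           ∀ i → toℕ i ≤ fs i
strictlyIncreasing⇒toℕ≤ fs↑ i =
  ≤-trans (m≤n+m (toℕ i) _) (strictlyIncreasing-gap fs↑ (toℕ i) Fin.zero i ≤-refl)

strictlyIncreasing⇒≤last : ∀ {m} {fs : Fin (suc m) → ℕ} → StrictlyIncreasing fs →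
                           ∀ i → fs i + (m ∸ toℕ i) ≤ fs (fromℕ m)
strictlyIncreasing⇒≤last {m} fs↑ i = strictlyIncreasing-gap fs↑ (m ∸ toℕ i) i (fromℕ m)
  (≤-reflexive (trans (m+[n∸m]≡n (m<1+n⇒m≤n (toℕ<n i))) (sym (toℕ-fromℕ m))))

∀Fin⇒∀< : ∀ {n} (R : ℕ → Set) → (∀ (i : Fin n) → R (toℕ i)) → ∀ j → j < n → R j
∀Fin⇒∀< R H j j<n = subst R (toℕ-fromℕ< j<n) (H (fromℕ< j<n))

-- The summand of totalFake is local to its definition; it is recovered from the defining equation.
totalFakeSummand : ∀ s → (Fin (numValues s) → ℕ) → ℕ → ℕ
totalFakeSummand s fs = proj₁ summandEquation
  where
  summandEquation : ∃ λ g → totalFake s fs ≡ sumBelow (numValues s) g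
  summandEquation = _ , refl

totalFakeSummand-toℕ : ∀ s fs i → totalFakeSummand s fs (toℕ i) ≡ mult s (toℕ i) * fs i
totalFakeSummand-toℕ s fs i with toℕ i <? numValues s
... | yes i<r = cong (λ i′ → mult s (toℕ i) * fs i′) (fromℕ<-toℕ i i<r)
... | no  i≮r = ⊥-elim (i≮r (toℕ<n i))

module _ s (fs : Fin (numValues s) → ℕ) {h : ℕ → ℕ} where

  totalFake-≤ : (∀ i → mult s (toℕ i) * fs i ≤ h (toℕ i)) → totalFake s fs ≤ sumBelow (numValues s) h
  totalFake-≤ le = sumBelow-mono-≤ (numValues s) (∀Fin⇒∀< (λ j → totalFakeSummand s fs j ≤ h j)
    (λ i → subst (_≤ h (toℕ i)) (sym (totalFakeSummand-toℕ s fs i)) (le i)))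

  totalFake-≥ : (∀ i → h (toℕ i) ≤ mult s (toℕ i) * fs i) → sumBelow (numValues s) h ≤ totalFake s fs
  totalFake-≥ ge = sumBelow-mono-≤ (numValues s) (∀Fin⇒∀< (λ j → h j ≤ totalFakeSummand s fs j)
    (λ i → subst (h (toℕ i) ≤_) (sym (totalFakeSummand-toℕ s fs i)) (ge i)))

  totalFake-≡ : (∀ i → mult s (toℕ i) * fs i ≡ h (toℕ i)) → totalFake s fs ≡ sumBelow (numValues s) h
  totalFake-≡ eq = sumBelow-cong (numValues s) (∀Fin⇒∀< (λ j → totalFakeSummand s fs j ≡ h j)
    (λ i → trans (totalFakeSummand-toℕ s fs i) (eq i)))

IsMinimum-unique : ∀ {P : ℕ → Set} {a b} → IsMinimum P a → IsMinimum P b → a ≡ b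
IsMinimum-unique (Pa , a≤) (Pb , b≤) = ≤-antisym (a≤ _ Pb) (b≤ _ Pa)

maxValue : List ℕ → ℕ
maxValue s = foldr _⊔_ 0 s

minFake : List ℕ → ℕ
minFake s = sumBelow (numValues s) (λ j → j * mult s j)

maxFake : List ℕ → ℕ → ℕ
maxFake s k = sumBelow (numValues s) (λ j → mult s j * (k ∸ (maxValue s ∸ j)))

minFake-isMinimum : ∀ s → IsMinimum (HasGenSol s) (minFake s)
minFake-isMinimum s =
    (toℕ , (λ _ _ i<j → i<j) , totalFake-≡ s toℕ (λ i → *-comm _ (toℕ i)))
  , λ f (fs , fs↑ , total≡f) → subst (minFake s ≤_) total≡f (totalFake-≥ s fs λ i →
      subst (_≤ mult s (toℕ i) * fs i) (*-comm (mult s (toℕ i)) (toℕ i))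
        (*-monoʳ-≤ (mult s (toℕ i)) (strictlyIncreasing⇒toℕ≤ fs↑ i)))

minFake≡sum-of-tails : ∀ s →
  minFake s ≡ sumBelow (maxValue s) (λ j → sumBelow (maxValue s ∸ j) (λ l → mult s (suc (j + l))))
minFake≡sum-of-tails s =
  trans (sumBelow-suc (maxValue s) (λ j → j * mult s j)) (sumBelow-tails (maxValue s) (λ j → mult s (suc j)))

HasHeightSol⇒maxValue≤ : ∀ s {k f} → HasHeightSol s k f → maxValue s ≤ k
HasHeightSol⇒maxValue≤ s (fs , (fs↑ , _) , last≤k) = ≤-trans m≤last last≤k
  where
  m≤last : maxValue s ≤ fs (fromℕ (maxValue s))
  m≤last = subst (_≤ fs (fromℕ (maxValue s))) (toℕ-fromℕ (maxValue s)) (strictlyIncreasing⇒toℕ≤ fs↑ _)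

minFake-isMinimum-height : ∀ s {k} → maxValue s ≤ k → IsMinimum (HasHeightSol s k) (minFake s)
minFake-isMinimum-height s m≤k =
    (toℕ , proj₂ (proj₁ (minFake-isMinimum s)) , subst (_≤ _) (sym (toℕ-fromℕ (maxValue s))) m≤k)
  , λ f (fs , sol , _) → proj₂ (minFake-isMinimum s) f (fs , sol)

maxFake-isMaximum : ∀ s {k} → maxValue s ≤ k → IsMaximum (HasHeightSol s k) (maxFake s k)
maxFake-isMaximum s {k} m≤k =
    (top , (top↑ , totalFake-≡ s top (λ _ → refl)) , top-last)
  , λ f (fs , (fs↑ , total≡f) , last≤k) → subst (_≤ maxFake s k) total≡f (totalFake-≤ s fs λ i →
      *-monoʳ-≤ (mult s (toℕ i)) (m+n≤o⇒m≤o∸n (fs i) (≤-trans (strictlyIncreasing⇒≤last fs↑ i) last≤k)))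
  where
  m = maxValue s
  top : Fin (numValues s) → ℕ
  top i = k ∸ (m ∸ toℕ i)
  top↑ : StrictlyIncreasing top
  top↑ i j i<j = ∸-monoʳ-< (∸-monoʳ-< i<j (m<1+n⇒m≤n (toℕ<n j))) (≤-trans (m∸n≤m m (toℕ i)) m≤k)
  top-last : top (fromℕ m) ≤ k
  top-last = ≤-reflexive (trans (cong (λ t → k ∸ (m ∸ t)) (toℕ-fromℕ m)) (cong (k ∸_) (n∸n≡0 m)))

-- The minimum for the reverse sequence, written with the multiplicities of s.
minFakeᴿ : List ℕ → ℕ
minFakeᴿ s = sumBelow (numValues s) (λ j → (maxValue s ∸ j) * mult s j)

minFake-reverse : ∀ s {s′} → IsReverse s s′ → minFake s′ ≡ minFakeᴿ s
minFake-reverse s {s′} (_ , _ , r′≡r , pm′≡pm) = begin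
  minFake s′
    ≡⟨ cong (λ r → sumBelow r (λ j → j * mult s′ j)) r′≡r ⟩
  sumBelow (suc m) (λ j → j * mult s′ j)
    ≡⟨ sumBelow-cong (suc m) (λ j j<r → cong (j *_) (mult′≡ j j<r)) ⟩
  sumBelow (suc m) (λ j → j * mult s (m ∸ j))
    ≡⟨ sumBelow-reverse (suc m) _ ⟩
  sumBelow (suc m) (λ j → (m ∸ j) * mult s (m ∸ (m ∸ j)))
    ≡⟨ sumBelow-cong (suc m) (λ j j<r → cong (λ t → (m ∸ j) * mult s t) (m∸[m∸n]≡n (m<1+n⇒m≤n j<r))) ⟩
  minFakeᴿ s
    ∎
  where
  open ≡-Reasoning
  m = maxValue s
  mult′≡ : ∀ j → j < suc m → mult s′ j ≡ mult s (m ∸ j)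
  mult′≡ j j<r = trans (pm′≡pm (suc j) (s≤s z≤n) j<r) (cong (mult s) (m+n∸n≡m (m ∸ j) 1))

maxFake+minFakeᴿ≡p*k : ∀ s {k} → maxValue s ≤ k → maxFake s k + minFakeᴿ s ≡ length s * k
maxFake+minFakeᴿ≡p*k s {k} m≤k = begin
  maxFake s k + minFakeᴿ s
    ≡⟨ sym (sumBelow-distrib-+ (numValues s) _ _) ⟩
  sumBelow (numValues s) (λ j → q j * (k ∸ (m ∸ j)) + (m ∸ j) * q j)
    ≡⟨ sumBelow-cong (numValues s) (λ j _ → pile j) ⟩
  sumBelow (numValues s) (λ j → q j * k)
    ≡⟨ sumBelow-*ʳ (numValues s) q k ⟩
  sumBelow (numValues s) q * k
    ≡⟨ cong (_* k) (sumBelow-mult≡length s (numValues s) ≤-refl) ⟩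
  length s * k
    ∎
  where
  open ≡-Reasoning
  m = maxValue s
  q = mult s
  pile : ∀ j → q j * (k ∸ (m ∸ j)) + (m ∸ j) * q j ≡ q j * k
  pile j = begin
    q j * (k ∸ (m ∸ j)) + (m ∸ j) * q j   ≡⟨ cong (q j * (k ∸ (m ∸ j)) +_) (*-comm (m ∸ j) (q j)) ⟩
    q j * (k ∸ (m ∸ j)) + q j * (m ∸ j)   ≡⟨ sym (*-distribˡ-+ (q j) (k ∸ (m ∸ j)) (m ∸ j)) ⟩
    q j * (k ∸ (m ∸ j) + (m ∸ j))         ≡⟨ cong (q j *_) (m∸n+n≡m (≤-trans (m∸n≤m m j) m≤k)) ⟩
    q j * k                               ∎

maxFake≡p*k∸minFake-reverse : ∀ s {k s′ F′} → maxValue s ≤ k → IsReverse s s′ →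
                              IsMinimum (HasGenSol s′) F′ → maxFake s k ≡ length s * k ∸ F′
maxFake≡p*k∸minFake-reverse s {k} {s′} {F′} m≤k rev F′-min = begin
  maxFake s k
    ≡⟨ sym (m+n∸n≡m (maxFake s k) (minFakeᴿ s)) ⟩
  maxFake s k + minFakeᴿ s ∸ minFakeᴿ s
    ≡⟨ cong₂ _∸_ (maxFake+minFakeᴿ≡p*k s m≤k) (sym (minFake-reverse s rev)) ⟩
  length s * k ∸ minFake s′
    ≡⟨ cong (length s * k ∸_) (IsMinimum-unique (minFake-isMinimum s′) F′-min) ⟩
  length s * k ∸ F′
    ∎
  where open ≡-Reasoning

mainTheorem3 : (s : List ℕ) → IsSortingSeq s → 1 < numValues s →
    let r = numValues s
        Fmin = sumRange 1 r (λ i → (i ∸ 1) * pm s i)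
    in IsMinimum (HasGenSol s) Fmin
       × Fmin ≡ sumRange 2 r (λ i → sumRange i r (pm s))
       × (∀ k → k < r ∸ 1 → ∀ f → ¬ HasHeightSol s k f)
       × (∀ k → r ∸ 1 ≤ k →
            IsMinimum (HasHeightSol s k) Fmin
            × (∀ s' → IsReverse s s' → ∀ F'min → IsMinimum (HasGenSol s') F'min →
                 IsMaximum (HasHeightSol s k) (length s * k ∸ F'min)))
-- Fmin unfolds to minFake s and r ∸ 1 to maxValue s.
mainTheorem3 s _ _ =
    minFake-isMinimum s
  , minFake≡sum-of-tails s
  , (λ k k<m _ sol → <⇒≱ k<m (HasHeightSol⇒maxValue≤ s sol))
  , λ k m≤k → minFake-isMinimum-height s m≤k
            , λ s′ rev F′ F′-min →
                subst (IsMaximum (HasHeightSol s k)) (maxFake≡p*k∸minFake-reverse s m≤k rev F′-min)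
                      (maxFake-isMaximum s m≤k)
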